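{- Let $\mathcal{C}=\langle\ell_0,\ell_1,\dots,\ell_k\rangle$ ($k\ge1$) be a caterpillar ladder together with a map $\phi$ satisfying (P1), (P2) and (P3$^\uparrow$) with respect to a tree-child network $\mathcal{N}$ on $X$ (i.e. a loose caterpillar ladder $\mathcal{C}_k^\uparrow$ of $\mathcal{N}$), and let $e_j=(\phi(p_j),\phi(v_j))$, $f_j=(\phi(q_j),\phi(v_j))$. If $\mathcal{E}$ and $\mathcal{E}'$ are two embeddings of the same phylogenetic $X$-tree $\mathcal{T}$ in $\mathcal{N}$ such that $\mathcal{E}$ uses $\{e_1,e_2,\dots,e_k\}$ and $\mathcal{E}'$ uses $f_1$, then $\mathcal{E}'$ also uses $\{f_2,f_3,\dots,f_k\}$.
   Context: A (rooted binary) phylogenetic network on a finite nonempty set $X$ is a rooted acyclic directed graph with no parallel arcs such that the root has in-degree 0 and out-degree 2; the leaves (out-degree 0) have in-degree 1 and are exactly the elements of $X$; every other vertex is a tree vertex (in-degree 1, out-degree 2) or a reticulation (in-degree 2, out-degree 1). A tree path is a directed path $v_1,\dots,v_n$ ($n\ge1$) with each of $v_2,\dots,v_n$ a tree vertex or a leaf. The network is tree-child if every non-leaf vertex has a child that is a tree vertex or a leaf. A phylogenetic $X$-tree is a phylogenetic network on $X$ with no reticulations. An embedding of a phylogenetic tree $\mathcal{T}$ in $\mathcal{N}$ is a set of arcs of $\mathcal{N}$ inducing a subdivision of $\mathcal{T}$; it uses the arcs it contains. Caterpillar ladder: for $k\ge1$ and distinct labels $\ell_0,\dots,\ell_k$,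 $\langle\ell_0,\dots,\ell_k\rangle$ has vertices $\ell_0,\dots,\ell_k$ and $v_j,p_j,q_j$ ($1\le j\le k$); arcs: if $k=1$, $(q_1,p_1)$ and $(p_1,\ell_0)$; if $k\ge2$, the arcs of the directed path $q_k,q_{k-1},p_k,q_{k-2},p_{k-1},\dots,q_2,p_3,q_1,p_2,p_1,\ell_0$; and for each $j$, $(p_j,v_j),(q_j,v_j),(v_j,\ell_j)$. The spine is the path $q_k,q_{k-1},p_k,\dots,q_1,p_2,p_1$ (the arc $(q_1,p_1)$ if $k=1$). When $k=1$, $q_0$ denotes $p_1$ and $p_2$ denotes $q_1$. Let $\{\ell_0,\dots,\ell_k\}\subseteq X$ and let $\phi$ be an injective map from the vertices of the ladder to those of $\mathcal{N}$ with $\phi(\ell_j)=\ell_j$. Conditions: (P1) there are tree paths in $\mathcal{N}$ from $\phi(p_1)$ to $\ell_0$ and from $\phi(v_j)$ to $\ell_j$ for each $j\ge1$; (P2) $(\phi(p_j),\phi(v_j))$ and $(\phi(q_j),\phi(v_j))$ are arcs of $\mathcal{N}$ for each $j$; (P3$^\uparrow$) for each spine arc $(u,w)\neq(q_k,q_{k-1})$ there is a tree path from $\phi(u)$ to $\phi(w)$ in $\mathcal{N}$, and there is a directed path from $\phi(q_k)$ to $\phi(q_{k-1})$ in $\mathcal{N}$. -}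

module Defs where

open import Data.Nat using (ℕ; zero; suc; _≤_; _<_)
open import Data.Fin using (Fin)
open import Data.Bool using (Bool; true; false)
open import Data.List using (List; []; _∷_; map; _++_; allFin)
open import Data.Sum using (_⊎_; inj₁; inj₂)
open import Data.Product using (Σ; _×_; _,_)
open import Data.Empty using (⊥)
open import Relation.Nullary using (¬_)
open import Relation.Binary.PropositionalEquality using (_≡_; _≢_)

-- Directed graphs whose vertex set is X ⊎ (internal vertices),
-- with X = Fin m the label set (leaves are exactly the elements of X)
-- and Fin n the non-leaf vertices.  Arcs are a Bool-valued relation,
-- so there are no parallel arcs.

Vtx : ℕ → ℕ → Set
Vtx m n = Fin m ⊎ Fin n

record Digraph (m n : ℕ) : Set where
  field
    arc : Vtx m n → Vtx m n → Bool
open Digraph public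

allV : (m n : ℕ) → List (Vtx m n)
allV m n = map inj₁ (allFin m) ++ map inj₂ (allFin n)

countTrue : List Bool → ℕ
countTrue [] = zero
countTrue (true ∷ bs) = suc (countTrue bs)
countTrue (false ∷ bs) = countTrue bs

module _ {m n : ℕ} (G : Digraph m n) where

  Arc : Vtx m n → Vtx m n → Set
  Arc u w = arc G u w ≡ true

  indeg : Vtx m n → ℕ
  indeg v = countTrue (map (λ u → arc G u v) (allV m n))

  outdeg : Vtx m n → ℕ
  outdeg v = countTrue (map (λ w → arc G v w) (allV m n))

  IsLeaf : Vtx m n → Set
  IsLeaf v = indeg v ≡ 1 × outdeg v ≡ 0

  IsTreeVertex : Vtx m n → Set
  IsTreeVertex v = indeg v ≡ 1 × outdeg v ≡ 2

  IsReticulation : Vtx m n → Set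
  IsReticulation v = indeg v ≡ 2 × outdeg v ≡ 1

  TreeOrLeaf : Vtx m n → Set
  TreeOrLeaf v = IsTreeVertex v ⊎ IsLeaf v

  -- directed walks (in an acyclic graph these are directed paths)
  data Walk : Vtx m n → Vtx m n → Set where
    []  : ∀ {v} → Walk v v
    _∷_ : ∀ {u w z} → Arc u w → Walk w z → Walk u z

  data TreePath : Vtx m n → Vtx m n → Set where
    here : ∀ {v} → TreePath v v
    step : ∀ {u w z} → Arc u w → TreeOrLeaf w → TreePath w z → TreePath u z

  ArcOn : ∀ {u z} → Walk u z → Vtx m n → Vtx m n → Set
  ArcOn [] a b = ⊥
  ArcOn (_∷_ {u} {w} _ p) a b = (a ≡ u × b ≡ w) ⊎ ArcOn p a b

  NotLast : ∀ {u z} → Walk u z → Vtx m n → Set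
  NotLast [] x = ⊥
  NotLast (_∷_ {u} _ p) x = x ≡ u ⊎ NotLast p x

  Interior : ∀ {u z} → Walk u z → Vtx m n → Set
  Interior [] x = ⊥
  Interior (_ ∷ p) x = NotLast p x

  record IsNetwork : Set where
    field
      root     : Fin n
      root-in  : indeg (inj₂ root) ≡ 0
      root-out : outdeg (inj₂ root) ≡ 2
      leaves   : ∀ x → IsLeaf (inj₁ x)
      others   : ∀ v → v ≡ root ⊎ IsTreeVertex (inj₂ v) ⊎ IsReticulation (inj₂ v)
      acyclic  : ∀ u w → Arc u w → ¬ Walk w u

  TreeChild : Set
  TreeChild = ∀ v → Σ (Vtx m n) λ w → Arc (inj₂ v) w × TreeOrLeaf w

IsPhyloTree : ∀ {m n} → Digraph m n → Set
IsPhyloTree {m} {n} T = IsNetwork T × (∀ (v : Vtx m n) → ¬ IsReticulation T v)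

-- Embeddings: a set E of arcs of N inducing a subdivision of T
-- (labels preserved).  ψ maps the vertices of T to the branching
-- vertices of the subdivision, each arc of T is replaced by a directed
-- path of N, the paths have pairwise disjoint interiors avoiding the
-- image of ψ, and E is exactly the union of the arcs of these paths.

record Embedding {m n n'} (N : Digraph m n) (T : Digraph m n')
                 (E : Vtx m n → Vtx m n → Bool) : Set where
  field
    E⊆N       : ∀ u w → E u w ≡ true → Arc N u w
    ψ         : Vtx m n' → Vtx m n
    ψ-inj     : ∀ a b → ψ a ≡ ψ b → a ≡ b
    ψ-leaf    : ∀ x → ψ (inj₁ x) ≡ inj₁ x
    P         : ∀ a b → Arc T a b → Walk N (ψ a) (ψ b)
    P-avoid   : ∀ a b (h : Arc T a b) c → ¬ Interior N (P a b h) (ψ c)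
    P-disj    : ∀ a b (h : Arc T a b) a' b' (h' : Arc T a' b') x →
                Interior N (P a b h) x → Interior N (P a' b' h') x →
                (a ≡ a' × b ≡ b')
    E-sound   : ∀ u w → E u w ≡ true →
                Σ (Vtx m n') λ a → Σ (Vtx m n') λ b → Σ (Arc T a b) λ h →
                ArcOn N (P a b h) u w
    E-complete : ∀ a b (h : Arc T a b) u w → ArcOn N (P a b h) u w → E u w ≡ true

Uses : ∀ {m n} → (Vtx m n → Vtx m n → Bool) → Vtx m n → Vtx m n → Set
Uses E u w = E u w ≡ true

-- Caterpillar ladder ⟨ℓ₀,…,ℓₖ⟩: vertices ℓ_j (0 ≤ j ≤ k) and
-- v_j, p_j, q_j (1 ≤ j ≤ k); indices are natural numbers, and only
-- the valid ones (see LValid) belong to the ladder.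

data LVert : Set where
  lab : ℕ → LVert
  vv  : ℕ → LVert
  pp  : ℕ → LVert
  qq  : ℕ → LVert

LValid : ℕ → LVert → Set
LValid k (lab j) = j ≤ k
LValid k (vv j) = 1 ≤ j × j ≤ k
LValid k (pp j) = 1 ≤ j × j ≤ k
LValid k (qq j) = 1 ≤ j × j ≤ k

-- q_j with the convention q₀ = p₁
q' : ℕ → LVert
q' zero = pp 1
q' (suc j) = qq (suc j)

-- Spine of ⟨ℓ₀,…,ℓₖ⟩: arc (q_k, q_{k-1}) followed, for j = k-1,…,1,
-- by the arcs (q_j, p_{j+1}) and (p_{j+1}, q_{j-1})   (q₀ = p₁).
record LooseLadder {m n} (N : Digraph m n) (k : ℕ)
                   (ℓ : ℕ → Fin m) (φ : LVert → Vtx m n) : Set where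
  field
    φ-inj : ∀ a b → LValid k a → LValid k b → φ a ≡ φ b → a ≡ b
    φ-lab : ∀ j → j ≤ k → φ (lab j) ≡ inj₁ (ℓ j)
    P1-0  : TreePath N (φ (pp 1)) (inj₁ (ℓ 0))
    P1    : ∀ j → 1 ≤ j → j ≤ k → TreePath N (φ (vv j)) (inj₁ (ℓ j))
    P2-e  : ∀ j → 1 ≤ j → j ≤ k → Arc N (φ (pp j)) (φ (vv j))
    P2-f  : ∀ j → 1 ≤ j → j ≤ k → Arc N (φ (qq j)) (φ (vv j))
    P3-top : Walk N (φ (qq k)) (φ (q' (k Data.Nat.∸ 1)))
    P3-a  : ∀ j → 1 ≤ j → j < k → TreePath N (φ (qq j)) (φ (pp (suc j)))
    P3-b  : ∀ j → 1 ≤ j → j < k → TreePath N (φ (pp (suc j))) (φ (q' (j Data.Nat.∸ 1)))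

-- The arcs used by an embedding form a subdivision of T, so every vertex has at
-- most one used in-arc, and a tree path to a leaf lying below the image of the
-- root of T is used entirely.  We propagate f_i to f_{i+1}: in E′ the vertex
-- v_{i+1} has a used in-arc, e_{i+1} or f_{i+1}.  If it were e_{i+1}, then in E
-- the vertex p_i branches towards ℓ_i and ℓ₀ at a vertex c of T, and in E′
-- the vertex p_{i+1} branches towards ℓ_{i+1} and ℓ₀ at a vertex d.
-- As c and d are ancestors of ℓ₀ they are comparable: c ≤ d gives a used path
-- of E from p_i to ℓ_{i+1}, d ≤ c a used path of E′ from p_{i+1} to ℓ_i.  Either
-- path must merge with the used path through the reticulation v_{i+1}
-- (respectively v_i), which creates a cycle or makes that reticulation a tree
-- vertex.
module Submission where

open import Data.Nat using (ℕ; zero; suc; _≤_; _<_; z≤n; s≤s)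
open import Data.Nat.Properties using (≤-refl; ≤-trans; ≤-reflexive; m≤n⇒m≤1+n; <⇒≤)
open import Data.Fin as Fin using (Fin)
open import Data.Bool using (Bool; true; false)
open import Data.Bool.Properties using () renaming (_≟_ to _≟𝔹_)
open import Data.List using (List; _∷_; map; filter; length; allFin)
open import Data.List.Properties using (filter-notAll)
open import Data.List.Membership.Propositional using (_∈_)
open import Data.List.Membership.Propositional.Properties
  using (∈-filter⁺; ∈-map⁺; ∈-++⁺ˡ; ∈-++⁺ʳ; ∈-allFin)
open import Data.List.Relation.Unary.Any as Any using (here; there)
open import Data.Sum using (_⊎_; inj₁; inj₂)
open import Data.Sum.Properties using (≡-dec)
open import Data.Product using (Σ; ∃; _×_; _,_; proj₁; proj₂)
open import Data.Empty using (⊥-elim)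
open import Function using (_∘_)
open import Relation.Nullary using (¬_; ¬?; yes; no)
open import Relation.Binary.Definitions using (DecidableEquality)
open import Relation.Binary.PropositionalEquality using (_≡_; _≢_; refl; subst; sym; trans)
open import Relation.Binary.Construct.Closure.ReflexiveTransitive using (Star; ε; _◅_; _◅◅_)
import Relation.Binary.Construct.Closure.ReflexiveTransitive as Star
open import Axiom.UniquenessOfIdentityProofs using (module Decidable⇒UIP)

open import Defs

module _ {A : Set} {R : A → A → Set} where

  unsnoc : ∀ {a z} → Star R a z → a ≡ z ⊎ ∃ λ y → Star R a y × R y z
  unsnoc ε = inj₁ refl
  unsnoc (r ◅ s) with unsnoc s
  ... | inj₁ refl = inj₂ (_ , ε , r)
  ... | inj₂ (y , s′ , r′) = inj₂ (y , r ◅ s′ , r′)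

  uncons : ∀ {a z} → a ≢ z → Star R a z → ∃ λ y → R a y × Star R y z
  uncons a≢z ε = ⊥-elim (a≢z refl)
  uncons _ (r ◅ s) = _ , r , s

  star-comparable : (∀ {a a′ b} → R a b → R a′ b → a ≡ a′) →
           ∀ {a b z} → Star R a z → Star R b z → Star R a b ⊎ Star R b a
  star-comparable unique ε t = inj₂ t
  star-comparable unique (r ◅ s) t with star-comparable unique s t
  ... | inj₁ s′ = inj₁ (r ◅ s′)
  ... | inj₂ t′ with unsnoc t′
  ...   | inj₁ refl = inj₁ (r ◅ ε)
  ...   | inj₂ (_ , t″ , r′) with unique r′ r
  ...     | refl = inj₂ t″

module _ {V : Set} (_≟_ : DecidableEquality V) {vs : List V} (complete : ∀ v → v ∈ vs)
         {R : V → V → Set} (acyclic : ∀ {u w} → R u w → ¬ Star R w u)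
         {G : V → Set} (G-or-parent : ∀ v → G v ⊎ ∃ λ u → R u v) where

  -- Climbing from c, the vertices outside `rest` are all descendants of c;
  -- acyclicity makes every new parent a member of `rest`, which then shrinks.
  private
    climb : ∀ fuel (rest : List V) → length rest < fuel → ∀ {c v} → Star R c v →
            (∀ x → ¬ Star R c x → x ∈ rest) → ∃ λ g → G g × Star R g v
    climb (suc fuel) rest (s≤s shorter) {c} c⇝v outside with G-or-parent c
    ... | inj₁ gc = c , gc , c⇝v
    ... | inj₂ (u , u→c) =
      climb fuel (filter (λ y → ¬? (u ≟ y)) rest) (≤-trans shrinks shorter) (u→c ◅ c⇝v) outside′
      where
        shrinks = filter-notAll (λ y → ¬? (u ≟ y)) rest
                    (Any.map (λ u≡y u≢y → u≢y u≡y) (outside u (acyclic u→c)))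
        outside′ : ∀ x → ¬ Star R u x → x ∈ filter (λ y → ¬? (u ≟ y)) rest
        outside′ x u↛x = ∈-filter⁺ (λ y → ¬? (u ≟ y)) (outside x (u↛x ∘ (u→c ◅_)))
                                   (λ { refl → u↛x ε })

  ancestor-satisfying : ∀ v → ∃ λ g → G g × Star R g v
  ancestor-satisfying v = climb (suc (length vs)) vs ≤-refl ε (λ x _ → complete x)

module _ {A : Set} (f : A → Bool) where

  private
    countTrue-∷ : ∀ y ys → countTrue (map f ys) ≤ countTrue (map f (y ∷ ys))
    countTrue-∷ y ys with f y
    ... | true = m≤n⇒m≤1+n ≤-refl
    ... | false = ≤-refl

  countTrue-≥1 : ∀ {x xs} → x ∈ xs → f x ≡ true → 1 ≤ countTrue (map f xs)
  countTrue-≥1 (here refl) fx rewrite fx = s≤s z≤n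
  countTrue-≥1 {xs = y ∷ ys} (there p) fx = ≤-trans (countTrue-≥1 p fx) (countTrue-∷ y ys)

  countTrue-≥2 : ∀ {x y xs} → x ≢ y → x ∈ xs → y ∈ xs → f x ≡ true → f y ≡ true →
                 2 ≤ countTrue (map f xs)
  countTrue-≥2 x≢y (here refl) (here refl) _ _ = ⊥-elim (x≢y refl)
  countTrue-≥2 _ (here refl) (there q) fx fy rewrite fx = s≤s (countTrue-≥1 q fy)
  countTrue-≥2 _ (there p) (here refl) fx fy rewrite fy = s≤s (countTrue-≥1 p fx)
  countTrue-≥2 {xs = z ∷ zs} x≢y (there p) (there q) fx fy =
    ≤-trans (countTrue-≥2 x≢y p q fx fy) (countTrue-∷ z zs)

  countTrue-≥3 : ∀ {x y w xs} → x ≢ y → x ≢ w → y ≢ w → x ∈ xs → y ∈ xs → w ∈ xs →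
                 f x ≡ true → f y ≡ true → f w ≡ true → 3 ≤ countTrue (map f xs)
  countTrue-≥3 x≢y _ _ (here refl) (here refl) _ _ _ _ = ⊥-elim (x≢y refl)
  countTrue-≥3 _ x≢w _ (here refl) _ (here refl) _ _ _ = ⊥-elim (x≢w refl)
  countTrue-≥3 _ _ y≢w _ (here refl) (here refl) _ _ _ = ⊥-elim (y≢w refl)
  countTrue-≥3 _ _ y≢w (here refl) (there q) (there r) fx fy fw rewrite fx =
    s≤s (countTrue-≥2 y≢w q r fy fw)
  countTrue-≥3 _ x≢w _ (there p) (here refl) (there r) fx fy fw rewrite fy =
    s≤s (countTrue-≥2 x≢w p r fx fw)
  countTrue-≥3 x≢y _ _ (there p) (there q) (here refl) fx fy fw rewrite fw =
    s≤s (countTrue-≥2 x≢y p q fx fy)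
  countTrue-≥3 {xs = z ∷ zs} x≢y x≢w y≢w (there p) (there q) (there r) fx fy fw =
    ≤-trans (countTrue-≥3 x≢y x≢w y≢w p q r fx fy fw) (countTrue-∷ z zs)

  countTrue-witness : ∀ xs → 1 ≤ countTrue (map f xs) → ∃ λ x → f x ≡ true
  countTrue-witness (y ∷ ys) h with f y in fy
  ... | true = y , fy
  ... | false = countTrue-witness ys h

module DigraphFacts {m n : ℕ} (D : Digraph m n) where

  _≟V_ : DecidableEquality (Vtx m n)
  _≟V_ = ≡-dec Fin._≟_ Fin._≟_

  ∈-allV : ∀ v → v ∈ allV m n
  ∈-allV (inj₁ x) = ∈-++⁺ˡ (∈-map⁺ inj₁ (∈-allFin x))
  ∈-allV (inj₂ x) = ∈-++⁺ʳ (map inj₁ (allFin m)) (∈-map⁺ inj₂ (∈-allFin x))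

  parent-exists : ∀ {v} → 1 ≤ indeg D v → ∃ λ u → Arc D u v
  parent-exists {v} = countTrue-witness (λ u → arc D u v) (allV m n)

  parent-unique : ∀ {u u′ v} → indeg D v ≤ 1 → Arc D u v → Arc D u′ v → u ≡ u′
  parent-unique {u} {u′} {v} indeg≤1 u→v u′→v with u ≟V u′
  ... | yes u≡u′ = u≡u′
  ... | no u≢u′
    with ≤-trans (countTrue-≥2 (λ x → arc D x v) u≢u′ (∈-allV u) (∈-allV u′) u→v u′→v) indeg≤1
  ...   | s≤s ()

  parent-of-two : ∀ {u u′ x v} → indeg D v ≤ 2 → Arc D u v → Arc D u′ v → u ≢ u′ →
                  Arc D x v → x ≡ u ⊎ x ≡ u′
  parent-of-two {u} {u′} {x} {v} indeg≤2 u→v u′→v u≢u′ x→v with x ≟V u | x ≟V u′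
  ... | yes x≡u | _ = inj₁ x≡u
  ... | no _ | yes x≡u′ = inj₂ x≡u′
  ... | no x≢u | no x≢u′
    with ≤-trans (countTrue-≥3 (λ y → arc D y v) u≢u′ (x≢u ∘ sym) (x≢u′ ∘ sym)
                    (∈-allV u) (∈-allV u′) (∈-allV x) u→v u′→v x→v) indeg≤2
  ...   | s≤s (s≤s ())

  TreeArc : Vtx m n → Vtx m n → Set
  TreeArc u w = Arc D u w × TreeOrLeaf D w

  star⇒walk : ∀ {u w} → Star (Arc D) u w → Walk D u w
  star⇒walk ε = []
  star⇒walk (r ◅ s) = r ∷ star⇒walk s

  treePath⇒star : ∀ {u w} → TreePath D u w → Star TreeArc u w
  treePath⇒star here = ε
  treePath⇒star (step r t p) = (r , t) ◅ treePath⇒star p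

  module _ {S : Vtx m n → Vtx m n → Set} where

    walk-star : ∀ {x z} (p : Walk D x z) → (∀ {a b} → ArcOn D p a b → S a b) → Star S x z
    walk-star [] f = ε
    walk-star (r ∷ p) f = f (inj₁ (refl , refl)) ◅ walk-star p (f ∘ inj₂)

    arcOn-split : ∀ {x z u w} (p : Walk D x z) → ArcOn D p u w →
                  (∀ {a b} → ArcOn D p a b → S a b) → Star S x u × Star S w z
    arcOn-split (r ∷ p) (inj₁ (refl , refl)) f = ε , walk-star p (f ∘ inj₂)
    arcOn-split (r ∷ p) (inj₂ on) f with arcOn-split p on (f ∘ inj₂)
    ... | before , after = f (inj₁ (refl , refl)) ◅ before , after

  arcOn-arc : ∀ {x z u w} (p : Walk D x z) → ArcOn D p u w → Arc D u w
  arcOn-arc (r ∷ p) (inj₁ (refl , refl)) = r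
  arcOn-arc (r ∷ p) (inj₂ on) = arcOn-arc p on

  private
    arcOn-notLast : ∀ {x z u w} (p : Walk D x z) → ArcOn D p u w → NotLast D p u
    arcOn-notLast (r ∷ p) (inj₁ (refl , _)) = inj₁ refl
    arcOn-notLast (r ∷ p) (inj₂ on) = inj₂ (arcOn-notLast p on)

    ∷-final-arc : ∀ {x y z} (r : Arc D x y) (p : Walk D y z) → ∃ λ u → ArcOn D (r ∷ p) u z
    ∷-final-arc r [] = _ , inj₁ (refl , refl)
    ∷-final-arc r (r′ ∷ p) with ∷-final-arc r′ p
    ... | u , on = u , inj₂ on

  arcOn-source : ∀ {x z u w} (p : Walk D x z) → ArcOn D p u w → Interior D p u ⊎ u ≡ x
  arcOn-source (r ∷ p) (inj₁ (refl , _)) = inj₂ refl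
  arcOn-source (r ∷ p) (inj₂ on) = inj₁ (arcOn-notLast p on)

  arcOn-target : ∀ {x z u w} (p : Walk D x z) → ArcOn D p u w → Interior D p w ⊎ w ≡ z
  arcOn-target (r ∷ []) (inj₁ (_ , refl)) = inj₂ refl
  arcOn-target (r ∷ (r′ ∷ p)) (inj₁ (_ , refl)) = inj₁ (inj₁ refl)
  arcOn-target (r ∷ (r′ ∷ p)) (inj₂ on) with arcOn-target (r′ ∷ p) on
  ... | inj₁ i = inj₁ (inj₂ i)
  ... | inj₂ e = inj₂ e

  interior-entered : ∀ {x z w} (p : Walk D x z) → Interior D p w → ∃ λ u → ArcOn D p u w
  interior-entered (r ∷ (r′ ∷ p)) (inj₁ refl) = _ , inj₁ (refl , refl)
  interior-entered (r ∷ (r′ ∷ p)) (inj₂ i) with interior-entered (r′ ∷ p) i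
  ... | u , on = u , inj₂ on

  final-arc : ∀ {x z} (p : Walk D x z) → x ≢ z → ∃ λ u → ArcOn D p u z
  final-arc [] x≢z = ⊥-elim (x≢z refl)
  final-arc (r ∷ p) _ = ∷-final-arc r p

module NetworkFacts {m n : ℕ} {N : Digraph m n} (isN : IsNetwork N) where
  open IsNetwork isN
  open DigraphFacts N

  arc-acyclic : ∀ {u w} → Arc N u w → ¬ Star (Arc N) w u
  arc-acyclic u→w w⇝u = acyclic _ _ u→w (star⇒walk w⇝u)

  star-antisym : ∀ {u w} → Star (Arc N) u w → Star (Arc N) w u → u ≡ w
  star-antisym ε _ = refl
  star-antisym (r ◅ u⇝w) w⇝u = ⊥-elim (arc-acyclic r (u⇝w ◅◅ w⇝u))

  indeg≤2 : ∀ v → indeg N v ≤ 2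
  indeg≤2 (inj₁ x) rewrite proj₁ (leaves x) = s≤s z≤n
  indeg≤2 (inj₂ v) with others v
  ... | inj₁ refl rewrite root-in = z≤n
  ... | inj₂ (inj₁ (indeg≡1 , _)) rewrite indeg≡1 = s≤s z≤n
  ... | inj₂ (inj₂ (indeg≡2 , _)) rewrite indeg≡2 = ≤-refl

  treeOrLeaf-parent-unique : ∀ {u u′ v} → TreeOrLeaf N v → Arc N u v → Arc N u′ v → u ≡ u′
  treeOrLeaf-parent-unique (inj₁ (indeg≡1 , _)) = parent-unique (≤-reflexive indeg≡1)
  treeOrLeaf-parent-unique (inj₂ (indeg≡1 , _)) = parent-unique (≤-reflexive indeg≡1)

  star-into-treePath : ∀ {a b z} → Star TreeArc a z → Star (Arc N) b z →
                       Star (Arc N) b a ⊎ TreeOrLeaf N b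
  star-into-treePath ε b⇝z = inj₁ b⇝z
  star-into-treePath ((a→y , tol) ◅ y⇝z) b⇝z with star-into-treePath y⇝z b⇝z
  ... | inj₂ tol-b = inj₂ tol-b
  ... | inj₁ b⇝y with unsnoc b⇝y
  ...   | inj₁ refl = inj₂ tol
  ...   | inj₂ (x , b⇝x , x→y) with treeOrLeaf-parent-unique tol x→y a→y
  ...     | refl = inj₁ b⇝x

  walk-avoids-start : ∀ {w z u} (p : Walk N w z) → ¬ ArcOn N p u w
  walk-avoids-start p on = arc-acyclic (arcOn-arc p on) (proj₁ (arcOn-split p on (arcOn-arc p)))

  arcOn-parent-unique : ∀ {x z u u′ w} (p : Walk N x z) → ArcOn N p u w → ArcOn N p u′ w → u ≡ u′
  arcOn-parent-unique (r ∷ p) (inj₁ (refl , refl)) (inj₁ (refl , refl)) = refl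
  arcOn-parent-unique (r ∷ p) (inj₁ (refl , refl)) (inj₂ on) = ⊥-elim (walk-avoids-start p on)
  arcOn-parent-unique (r ∷ p) (inj₂ on) (inj₁ (refl , refl)) = ⊥-elim (walk-avoids-start p on)
  arcOn-parent-unique (r ∷ p) (inj₂ on) (inj₂ on′) = arcOn-parent-unique p on on′

module TreeFacts {m n : ℕ} {T : Digraph m n} (isT : IsPhyloTree T) where
  open IsNetwork (proj₁ isT)
  open DigraphFacts T

  private
    indeg≤1 : ∀ v → indeg T v ≤ 1
    indeg≤1 (inj₁ x) rewrite proj₁ (leaves x) = ≤-refl
    indeg≤1 (inj₂ v) with others v
    ... | inj₁ refl rewrite root-in = z≤n
    ... | inj₂ (inj₁ (indeg≡1 , _)) rewrite indeg≡1 = ≤-refl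
    ... | inj₂ (inj₂ ret) = ⊥-elim (proj₂ isT _ ret)

  tree-parent-unique : ∀ {a a′ b} → Arc T a b → Arc T a′ b → a ≡ a′
  tree-parent-unique = parent-unique (indeg≤1 _)

  root-or-parent : ∀ v → v ≡ inj₂ root ⊎ ∃ λ u → Arc T u v
  root-or-parent (inj₁ x) = inj₂ (parent-exists (≤-reflexive (sym (proj₁ (leaves x)))))
  root-or-parent (inj₂ v) with others v
  ... | inj₁ refl = inj₁ refl
  ... | inj₂ (inj₁ (indeg≡1 , _)) = inj₂ (parent-exists (≤-reflexive (sym indeg≡1)))
  ... | inj₂ (inj₂ ret) = ⊥-elim (proj₂ isT _ ret)

  root-reaches : ∀ v → Star (Arc T) (inj₂ root) v
  root-reaches v with ancestor-satisfying _≟V_ ∈-allV (λ r s → acyclic _ _ r (star⇒walk s))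
                        {G = _≡ inj₂ root} root-or-parent v
  ... | _ , refl , root⇝v = root⇝v

module EmbeddingFacts {m n n′ : ℕ} {N : Digraph m n} {T : Digraph m n′}
                      (isN : IsNetwork N) (isT : IsPhyloTree T)
                      {E : Vtx m n → Vtx m n → Bool} (emb : Embedding N T E) where
  open Embedding emb
  open DigraphFacts N
  open NetworkFacts isN
  open TreeFacts isT
  open Decidable⇒UIP _≟𝔹_ using () renaming (≡-irrelevant to 𝔹-uip)

  Entered : Vtx m n → Set
  Entered w = ∃ λ u → Uses E u w

  TArc : Set
  TArc = Σ (Vtx m n′) λ a → Σ (Vtx m n′) λ b → Arc T a b

  rootT : Vtx m n′
  rootT = inj₂ (IsNetwork.root (proj₁ isT))

  used⇒arc : ∀ {u w} → Uses E u w → Arc N u w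
  used⇒arc = E⊆N _ _

  used⇒arcs : ∀ {u w} → Star (Uses E) u w → Star (Arc N) u w
  used⇒arcs = Star.map used⇒arc

  ψ-arc-distinct : ∀ {a b} → Arc T a b → ψ a ≢ ψ b
  ψ-arc-distinct {a} {b} h e with ψ-inj a b e
  ... | refl = IsNetwork.acyclic (proj₁ isT) a a h []

  image-used : ∀ {a b} → Star (Arc T) a b → Star (Uses E) (ψ a) (ψ b)
  image-used ε = ε
  image-used (_◅_ {a} {b} h s) = walk-star (P a b h) (E-complete a b h _ _) ◅◅ image-used s

  ψ-entered : ∀ b → b ≡ rootT ⊎ Entered (ψ b)
  ψ-entered b with root-or-parent b
  ... | inj₁ b≡root = inj₁ b≡root
  ... | inj₂ (a , h) with final-arc (P a b h) (ψ-arc-distinct h)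
  ... | u , on = inj₂ (u , E-complete a b h u (ψ b) on)

  leaf-entered : ∀ x → Entered (inj₁ x)
  leaf-entered x with ψ-entered (inj₁ x)
  ... | inj₂ entered = subst Entered (ψ-leaf x) entered

  source-entered : ∀ {y w} → Uses E y w → y ≡ ψ rootT ⊎ Entered y
  source-entered {y} {w} f with E-sound y w f
  ... | a , b , h , on with arcOn-source (P a b h) on
  ... | inj₁ i = inj₂ (_ , E-complete a b h _ y (proj₂ (interior-entered (P a b h) i)))
  ... | inj₂ refl with ψ-entered a
  ...   | inj₁ refl = inj₁ refl
  ...   | inj₂ entered = inj₂ entered

  root-above : ∀ {u w} → Uses E u w → Star (Uses E) (ψ rootT) u
  root-above {u} {w} f with E-sound u w f
  ... | a , b , h , on =
    image-used (root-reaches a) ◅◅ proj₁ (arcOn-split (P a b h) on (E-complete a b h _ _))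

  interior-carrier-unique : ∀ {a b a′ b′ x} (h : Arc T a b) (h′ : Arc T a′ b′) →
                            Interior N (P a b h) x → Interior N (P a′ b′ h′) x →
                            _≡_ {A = TArc} (a , b , h) (a′ , b′ , h′)
  interior-carrier-unique {a} {b} {a′} {b′} {x} h h′ i i′ with P-disj a b h a′ b′ h′ x i i′
  ... | refl , refl with 𝔹-uip h h′
  ... | refl = refl

  target-carrier-unique : ∀ {a b a′ b′ y y′ w} (h : Arc T a b) (h′ : Arc T a′ b′) →
                          ArcOn N (P a b h) y w → ArcOn N (P a′ b′ h′) y′ w →
                          _≡_ {A = TArc} (a , b , h) (a′ , b′ , h′)
  target-carrier-unique {a} {b} {a′} {b′} h h′ on on′
    with arcOn-target (P a b h) on | arcOn-target (P a′ b′ h′) on′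
  ... | inj₁ i | inj₁ i′ = interior-carrier-unique h h′ i i′
  ... | inj₁ i | inj₂ refl = ⊥-elim (P-avoid a b h b′ i)
  ... | inj₂ refl | inj₁ i′ = ⊥-elim (P-avoid a′ b′ h′ b i′)
  ... | inj₂ e | inj₂ e′ with ψ-inj b b′ (trans (sym e) e′)
  ... | refl with tree-parent-unique h h′
  ... | refl with 𝔹-uip h h′
  ... | refl = refl

  used-parent-unique : ∀ {u u′ w} → Uses E u w → Uses E u′ w → u ≡ u′
  used-parent-unique {u} {u′} {w} f f′ with E-sound u w f | E-sound u′ w f′
  ... | a , b , h , on | a′ , b′ , h′ , on′ with target-carrier-unique h h′ on on′
  ... | refl = arcOn-parent-unique (P a b h) on on′

  used-successor : ∀ {a b y u u′} (h : Arc T a b) → ArcOn N (P a b h) y u → Uses E u u′ →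
                   ArcOn N (P a b h) u u′ ⊎ ∃ λ c → Σ (Arc T b c) λ h₂ → ArcOn N (P b c h₂) u u′
  used-successor {a} {b} {y} {u} {u′} h on f with E-sound u u′ f
  ... | a₂ , b₂ , h₂ , on₂ with arcOn-target (P a b h) on | arcOn-source (P a₂ b₂ h₂) on₂
  ... | inj₁ i | inj₁ i₂ with interior-carrier-unique h h₂ i i₂
  ...   | refl = inj₁ on₂
  used-successor {a} {b} h on f | a₂ , b₂ , h₂ , on₂ | inj₁ i | inj₂ refl =
    ⊥-elim (P-avoid a b h a₂ i)
  used-successor {a} {b} h on f | a₂ , b₂ , h₂ , on₂ | inj₂ refl | inj₁ i₂ =
    ⊥-elim (P-avoid a₂ b₂ h₂ b i₂)
  used-successor {a} {b} h on f | a₂ , b₂ , h₂ , on₂ | inj₂ e | inj₂ e₂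
    with ψ-inj b a₂ (trans (sym e) e₂)
  ... | refl = inj₂ (b₂ , h₂ , on₂)

  used-descends : ∀ {a b c y u} (h : Arc T a b) → ArcOn N (P a b h) y u →
                  Star (Uses E) u (ψ c) → Star (Arc T) b c
  used-descends {a} {b} {c} h on ε with arcOn-target (P a b h) on
  ... | inj₁ i = ⊥-elim (P-avoid a b h c i)
  ... | inj₂ e rewrite ψ-inj c b e = ε
  used-descends h on (f ◅ s) with used-successor h on f
  ... | inj₁ on′ = used-descends h on′ s
  ... | inj₂ (_ , h₂ , on₂) = h₂ ◅ used-descends h₂ on₂ s

  -- x is either ψ d itself or an interior vertex of the path leading to ψ d.
  branching : ∀ {x w₁ w₂ c₁ c₂} → Uses E x w₁ → Uses E x w₂ →
              Star (Uses E) w₁ (ψ c₁) → Star (Uses E) w₂ (ψ c₂) →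
              ∃ λ d → Star (Arc T) d c₁ × Star (Arc T) d c₂ ×
                      (∀ c → Star (Arc T) d c → Star (Uses E) x (ψ c))
  branching {x} {w₁} {w₂} f₁ f₂ s₁ s₂ with E-sound x w₁ f₁ | E-sound x w₂ f₂
  ... | a₁ , b₁ , h₁ , on₁ | a₂ , b₂ , h₂ , on₂
    with arcOn-source (P a₁ b₁ h₁) on₁ | arcOn-source (P a₂ b₂ h₂) on₂
  ... | inj₁ i₁ | inj₁ i₂ with interior-carrier-unique h₁ h₂ i₁ i₂
  ...   | refl = b₁ , used-descends h₁ on₁ s₁ , used-descends h₁ on₂ s₂ ,
                 λ c b₁⇝c → f₁ ◅ proj₂ (arcOn-split (P a₁ b₁ h₁) on₁ (E-complete a₁ b₁ h₁ _ _))
                               ◅◅ image-used b₁⇝c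
  branching f₁ f₂ s₁ s₂ | a₁ , b₁ , h₁ , on₁ | a₂ , b₂ , h₂ , on₂ | inj₁ i₁ | inj₂ refl =
    ⊥-elim (P-avoid a₁ b₁ h₁ a₂ i₁)
  branching f₁ f₂ s₁ s₂ | a₁ , b₁ , h₁ , on₁ | a₂ , b₂ , h₂ , on₂ | inj₂ refl | inj₁ i₂ =
    ⊥-elim (P-avoid a₂ b₂ h₂ a₁ i₂)
  branching f₁ f₂ s₁ s₂ | a₁ , b₁ , h₁ , on₁ | a₂ , b₂ , h₂ , on₂ | inj₂ refl | inj₂ e
    with ψ-inj a₁ a₂ e
  ... | refl = a₁ , h₁ ◅ used-descends h₁ on₁ s₁ , h₂ ◅ used-descends h₂ on₂ s₂ ,
               λ c a₁⇝c → image-used a₁⇝c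

  entered-below : ∀ {x y z} → Star (Arc N) (ψ rootT) x → Arc N x y →
                  Star TreeArc y z → Entered z → Entered y
  entered-below _ _ ε entered = entered
  entered-below root⇝x x→y ((y→y′ , tol) ◅ y′⇝z) entered
    with entered-below (root⇝x ◅◅ x→y ◅ ε) y→y′ y′⇝z entered
  ... | u , u↦y′ with treeOrLeaf-parent-unique tol (used⇒arc u↦y′) y→y′
  ... | refl with source-entered u↦y′
  ... | inj₁ refl = ⊥-elim (arc-acyclic x→y root⇝x)
  ... | inj₂ y-entered = y-entered

  treePath-used : ∀ {y z} → Star (Arc N) (ψ rootT) y → Star TreeArc y z → Entered z →
                  Star (Uses E) y z
  treePath-used _ ε _ = ε
  treePath-used root⇝y ((y→y′ , tol) ◅ y′⇝z) entered
    with entered-below root⇝y y→y′ y′⇝z entered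
  ... | u , u↦y′ with treeOrLeaf-parent-unique tol (used⇒arc u↦y′) y→y′
  ... | refl = u↦y′ ◅ treePath-used (root⇝y ◅◅ y→y′ ◅ ε) y′⇝z entered

  used-via-parent : ∀ {x u w} → Star (Uses E) x w → x ≢ w → Uses E u w → Star (Uses E) x u
  used-via-parent x⇝w x≢w u↦w with unsnoc x⇝w
  ... | inj₁ x≡w = ⊥-elim (x≢w x≡w)
  ... | inj₂ (y , x⇝y , y↦w) with used-parent-unique y↦w u↦w
  ... | refl = x⇝y

module LadderFacts {m n : ℕ} {N : Digraph m n} (isN : IsNetwork N)
                   {k : ℕ} {ℓ : ℕ → Fin m} {φ : LVert → Vtx m n} (L : LooseLadder N k ℓ φ) where
  open LooseLadder L
  open DigraphFacts N
  open NetworkFacts isN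

  p q v : ℕ → Vtx m n
  p j = φ (pp j)
  q j = φ (qq j)
  v j = φ (vv j)

  leaf : ∀ {n″} → ℕ → Vtx m n″
  leaf j = inj₁ (ℓ j)

  Rung : ℕ → Set
  Rung j = 1 ≤ j × j ≤ k

  rung-pred : ∀ {j} → Rung (suc (suc j)) → Rung (suc j)
  rung-pred (_ , j<k) = s≤s z≤n , <⇒≤ j<k

  φ-distinct : ∀ {a b} → LValid k a → LValid k b → a ≢ b → φ a ≢ φ b
  φ-distinct va vb a≢b = a≢b ∘ φ-inj _ _ va vb

  p≢leaf₀ : ∀ {j} → Rung j → p j ≢ leaf 0
  p≢leaf₀ r e = φ-distinct r z≤n (λ ()) (trans e (sym (φ-lab 0 z≤n)))

  p-arc : ∀ {j} → Rung j → Arc N (p j) (v j)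
  p-arc (1≤j , j≤k) = P2-e _ 1≤j j≤k

  q-arc : ∀ {j} → Rung j → Arc N (q j) (v j)
  q-arc (1≤j , j≤k) = P2-f _ 1≤j j≤k

  rung-path : ∀ {j} → Rung j → Star TreeArc (v j) (leaf j)
  rung-path (1≤j , j≤k) = treePath⇒star (P1 _ 1≤j j≤k)

  q-to-next-p : ∀ {i} → Rung i → Rung (suc i) → Star TreeArc (q i) (p (suc i))
  q-to-next-p (1≤i , _) (_ , i<k) = treePath⇒star (P3-a _ 1≤i i<k)

  spine-step : ∀ {i} → Rung i → Rung (suc i) → Star TreeArc (p (suc i)) (p i)
  spine-step {suc zero} _ (_ , i<k) = treePath⇒star (P3-b 1 (s≤s z≤n) i<k)
  spine-step {suc (suc i)} rᵢ (_ , i<k) =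
    treePath⇒star (P3-b _ (s≤s z≤n) i<k) ◅◅ q-to-next-p (rung-pred rᵢ) rᵢ

  spine-path : ∀ {j} → Rung j → Star TreeArc (p j) (leaf 0)
  spine-path {suc zero} _ = treePath⇒star P1-0
  spine-path {suc (suc j)} r = spine-step (rung-pred r) r ◅◅ spine-path (rung-pred r)

  reticulation-parent : ∀ {j u} → Rung j → Arc N u (v j) → u ≡ p j ⊎ u ≡ q j
  reticulation-parent r = parent-of-two (indeg≤2 _) (p-arc r) (q-arc r) (φ-distinct r r λ ())

  rung-not-tree : ∀ {j} → Rung j → ¬ TreeOrLeaf N (v j)
  rung-not-tree r tol = φ-distinct r r (λ ()) (treeOrLeaf-parent-unique tol (p-arc r) (q-arc r))

  treeArcs⇒arcs : ∀ {x y} → Star TreeArc x y → Star (Arc N) x y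
  treeArcs⇒arcs = Star.map proj₁

  module InEmbedding {n′ : ℕ} {T : Digraph m n′} (isT : IsPhyloTree T)
                     {F : Vtx m n → Vtx m n → Bool} (emb : Embedding N T F) where
    open Embedding emb using (ψ; ψ-leaf)
    open EmbeddingFacts isN isT emb

    to-ψ : ∀ {x y} → Star (Uses F) x (inj₁ y) → Star (Uses F) x (ψ (inj₁ y))
    to-ψ {x} {y} = subst (Star (Uses F) x) (sym (ψ-leaf y))

    from-ψ : ∀ {x y} → Star (Uses F) x (ψ (inj₁ y)) → Star (Uses F) x (inj₁ y)
    from-ψ {x} {y} = subst (Star (Uses F) x) (ψ-leaf y)

    rung-used : ∀ {j u} → Rung j → Uses F u (v j) → Star (Uses F) (v j) (leaf j)
    rung-used r u↦v = treePath-used (used⇒arcs (root-above u↦v) ◅◅ used⇒arc u↦v ◅ ε)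
                                    (rung-path r) (leaf-entered _)

    spine-used : ∀ {j} → Rung j → Uses F (p j) (v j) → Star (Uses F) (p j) (leaf 0)
    spine-used r e = treePath-used (used⇒arcs (root-above e)) (spine-path r) (leaf-entered _)

    rung-cluster : ∀ {j} → Rung j → Uses F (p j) (v j) →
                   ∃ λ d → Star (Arc T) d (leaf j) × Star (Arc T) d (leaf 0) ×
                           (∀ c → Star (Arc T) d c → Star (Uses F) (p j) (ψ c))
    rung-cluster r e with uncons (p≢leaf₀ r) (spine-used r e)
    ... | _ , f , rest = branching e f (to-ψ (rung-used r e)) (to-ψ rest)

    next-rung-entered : ∀ {i} → Rung i → Rung (suc i) → Uses F (q i) (v i) → Entered (v (suc i))
    next-rung-entered rᵢ rⱼ f =
      entered-below (used⇒arcs (root-above f) ◅◅ treeArcs⇒arcs (q-to-next-p rᵢ rⱼ))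
                    (p-arc rⱼ) (rung-path rⱼ) (leaf-entered _)

    no-path-to-next-leaf : ∀ {i} → Rung i → Rung (suc i) → Uses F (p (suc i)) (v (suc i)) →
                           ¬ Star (Uses F) (p i) (leaf (suc i))
    no-path-to-next-leaf rᵢ rⱼ e p⇝ℓ with star-comparable used-parent-unique p⇝ℓ (rung-used rⱼ e)
    ... | inj₁ p⇝v = φ-distinct rᵢ rⱼ (λ ())
      (star-antisym (used⇒arcs (used-via-parent p⇝v (φ-distinct rᵢ rⱼ λ ()) e))
                    (treeArcs⇒arcs (spine-step rᵢ rⱼ)))
    ... | inj₂ v⇝p with star-into-treePath (spine-step rᵢ rⱼ) (used⇒arcs v⇝p)
    ...   | inj₁ v⇝p′ = arc-acyclic (p-arc rⱼ) v⇝p′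
    ...   | inj₂ tol = rung-not-tree rⱼ tol

    no-path-to-previous-leaf : ∀ {i} → Rung i → Rung (suc i) → Uses F (q i) (v i) →
                               ¬ Star (Uses F) (p (suc i)) (leaf i)
    no-path-to-previous-leaf rᵢ rⱼ f p⇝ℓ with star-comparable used-parent-unique p⇝ℓ (rung-used rᵢ f)
    ... | inj₁ p⇝v = φ-distinct rⱼ rᵢ (λ ())
      (star-antisym (used⇒arcs (used-via-parent p⇝v (φ-distinct rⱼ rᵢ λ ()) f))
                    (treeArcs⇒arcs (q-to-next-p rᵢ rⱼ)))
    ... | inj₂ v⇝p = arc-acyclic (p-arc rᵢ) (used⇒arcs v⇝p ◅◅ treeArcs⇒arcs (spine-step rᵢ rⱼ))

  module _ {n′ : ℕ} {T : Digraph m n′} (isT : IsPhyloTree T) {E E′ : Vtx m n → Vtx m n → Bool}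
           (emb : Embedding N T E) (emb′ : Embedding N T E′) where
    open TreeFacts isT using (tree-parent-unique)
    private
      module 𝓔 = InEmbedding isT emb
      module 𝓔′ = InEmbedding isT emb′

    f-then-e-impossible : ∀ {i} → Rung i → Rung (suc i) →
                          Uses E (p i) (v i) → Uses E (p (suc i)) (v (suc i)) →
                          Uses E′ (q i) (v i) → ¬ Uses E′ (p (suc i)) (v (suc i))
    f-then-e-impossible rᵢ rⱼ eᵢ eⱼ fᵢ e′ⱼ with 𝓔.rung-cluster rᵢ eᵢ | 𝓔′.rung-cluster rⱼ e′ⱼ
    ... | c , c⇝ℓᵢ , c⇝ℓ₀ , c-below | d , d⇝ℓⱼ , d⇝ℓ₀ , d-below
      with star-comparable tree-parent-unique c⇝ℓ₀ d⇝ℓ₀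
    ... | inj₁ c⇝d = 𝓔.no-path-to-next-leaf rᵢ rⱼ eⱼ (𝓔.from-ψ (c-below _ (c⇝d ◅◅ d⇝ℓⱼ)))
    ... | inj₂ d⇝c = 𝓔′.no-path-to-previous-leaf rᵢ rⱼ fᵢ (𝓔′.from-ψ (d-below _ (d⇝c ◅◅ c⇝ℓᵢ)))

    next-f-used : ∀ {i} → Rung i → Rung (suc i) →
                  Uses E (p i) (v i) → Uses E (p (suc i)) (v (suc i)) →
                  Uses E′ (q i) (v i) → Uses E′ (q (suc i)) (v (suc i))
    next-f-used rᵢ rⱼ eᵢ eⱼ fᵢ with 𝓔′.next-rung-entered rᵢ rⱼ fᵢ
    ... | u , u↦v with reticulation-parent rⱼ (Embedding.E⊆N emb′ _ _ u↦v)
    ...   | inj₁ refl = ⊥-elim (f-then-e-impossible rᵢ rⱼ eᵢ eⱼ fᵢ u↦v)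
    ...   | inj₂ refl = u↦v

lemma5 : ∀ {m n n' : ℕ} (N : Digraph m n) → IsNetwork N → TreeChild N →
         (k : ℕ) → 1 ≤ k → (ℓ : ℕ → Fin m) (φ : LVert → Vtx m n) →
         LooseLadder N k ℓ φ →
         (T : Digraph m n') → IsPhyloTree T →
         (E E' : Vtx m n → Vtx m n → Bool) →
         Embedding N T E → Embedding N T E' →
         (∀ j → 1 ≤ j → j ≤ k → Uses E (φ (pp j)) (φ (vv j))) →
         Uses E' (φ (qq 1)) (φ (vv 1)) →
         ∀ j → 2 ≤ j → j ≤ k → Uses E' (φ (qq j)) (φ (vv j))
lemma5 N isN _ k _ ℓ φ L T isT E E′ emb emb′ e f₁ j 2≤j j≤k =
  propagate j (≤-trans (s≤s z≤n) 2≤j , j≤k)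
  where
    open LadderFacts isN L
    e-used : ∀ {j} → Rung j → Uses E (p j) (v j)
    e-used (1≤j , j≤k) = e _ 1≤j j≤k
    propagate : ∀ j → Rung j → Uses E′ (q j) (v j)
    propagate (suc zero) _ = f₁
    propagate (suc (suc j)) r =
      next-f-used isT emb emb′ (rung-pred r) r (e-used (rung-pred r)) (e-used r)
                  (propagate (suc j) (rung-pred r))
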